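{- Let $G$ be a finite, connected, undirected multigraph without loops, and let $e$ be an edge between distinct vertices $x$ and $y$. Let $G/e$ be the graph obtained by contracting $e$ (identifying $x$ and $y$; any loops thereby created are discarded). Let $S$ be the subgroup of $\mathrm{Jac}(G)$ generated by $[\delta_{xy}]$. Then $[\mathrm{Jac}(G):S]$ divides $\gcd(|\mathrm{Jac}(G)|,|\mathrm{Jac}(G/e)|)$.
   Context: For a finite connected loopless multigraph $H$ with vertex set $V(H)$: a divisor is an element of $\mathbb{Z}^{V(H)}$; $\mathrm{Div}^0(H)$ is the group of divisors of degree (sum of values) zero. The Laplacian is $L=\Delta-A$, where $\Delta$ is the diagonal matrix of valencies and $A_{vw}$ is the number of edges between $v,w$. $\mathrm{Jac}(H)=\mathrm{Div}^0(H)/\{L\sigma:\sigma\in\mathbb{Z}^{V(H)}\}$, a finite abelian group whose order equals the number of spanning trees of $H$. $\delta_{xy}$ is the divisor with $-1$ at $x$, $1$ at $y$, $0$ elsewhere. -}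

module Defs where

open import Data.Nat using (ℕ; zero; suc; _≤_)
open import Data.Integer as ℤ using (ℤ; +_; -_) renaming (_+_ to _+ℤ_; _-_ to _-ℤ_; _*_ to _*ℤ_)
open import Data.Fin using (Fin; zero; suc; punchOut)
open import Data.Fin.Properties using (_≟_)
open import Data.Product using (Σ; ∃; ∃-syntax; _×_; _,_)
open import Relation.Binary.PropositionalEquality using (_≡_; _≢_; sym)
open import Relation.Nullary using (yes; no)
open import Function using (_∘_)

-- A (loopless) multigraph on the vertex set Fin n is given by its adjacency
-- matrix: adj v w = number of edges between v and w.
Adj : ℕ → Set
Adj n = Fin n → Fin n → ℕ

Symmetric : ∀ {n} → Adj n → Set
Symmetric {n} A = ∀ (v w : Fin n) → A v w ≡ A w v

Loopless : ∀ {n} → Adj n → Set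
Loopless {n} A = ∀ (v : Fin n) → A v v ≡ 0

data Reachable {n} (A : Adj n) : Fin n → Fin n → Set where
  here : ∀ {v} → Reachable A v v
  step : ∀ {u w v} → 1 ≤ A u w → Reachable A w v → Reachable A u v

Connected : ∀ {n} → Adj n → Set
Connected {n} A = ∀ (u v : Fin n) → Reachable A u v

sumℕ : ∀ {n} → (Fin n → ℕ) → ℕ
sumℕ {zero}  f = 0
sumℕ {suc n} f = f zero Data.Nat.+ sumℕ (f ∘ suc)

sumℤ : ∀ {n} → (Fin n → ℤ) → ℤ
sumℤ {zero}  f = + 0
sumℤ {suc n} f = f zero +ℤ sumℤ (f ∘ suc)

Divisor : ℕ → Set
Divisor n = Fin n → ℤ

deg : ∀ {n} → Divisor n → ℤ
deg = sumℤ

valency : ∀ {n} → Adj n → Fin n → ℕ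
valency A v = sumℕ (A v)

laplacian : ∀ {n} → Adj n → (Fin n → ℤ) → Divisor n
laplacian A σ v = (+ valency A v) *ℤ σ v -ℤ sumℤ (λ w → (+ A v w) *ℤ σ w)

δ : ∀ {n} → Fin n → Fin n → Divisor n
δ x y v with v ≟ x | v ≟ y
... | yes _ | _     = - (+ 1)
... | no _  | yes _ = + 1
... | no _  | no _  = + 0

LinEquiv : ∀ {n} → Adj n → Divisor n → Divisor n → Set
LinEquiv {n} A D D' = ∃[ σ ] (∀ (v : Fin n) → D v -ℤ D' v ≡ laplacian A σ v)

-- equivalence modulo im L + ⟨δ_xy⟩ (i.e. equality of classes in Jac(G)/S)
EquivModS : ∀ {n} → Adj n → Fin n → Fin n → Divisor n → Divisor n → Set
EquivModS {n} A x y D D' =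
  Σ (Fin n → ℤ) λ σ → Σ ℤ λ m →
    ∀ (v : Fin n) → D v -ℤ D' v ≡ laplacian A σ v +ℤ m *ℤ δ x y v

-- "the quotient of Div⁰ by the relation R has exactly k elements":
-- a complete system of k pairwise inequivalent degree-zero representatives.
QuotientCard : ∀ {n} → (Divisor n → Divisor n → Set) → ℕ → Set
QuotientCard {n} R k =
  Σ (Fin k → Divisor n) λ rep →
    (∀ i → deg (rep i) ≡ + 0) ×
    (∀ i j → R (rep i) (rep j) → i ≡ j) ×
    (∀ (D : Divisor n) → deg D ≡ + 0 → ∃[ i ] R D (rep i))

JacOrder : ∀ {n} → Adj n → ℕ → Set
JacOrder A k = QuotientCard (LinEquiv A) k

JacIndexδ : ∀ {n} → Adj n → Fin n → Fin n → ℕ → Set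
JacIndexδ A x y k = QuotientCard (EquivModS A x y) k

-- contraction of the edge xy: vertex set Fin n obtained from Fin (suc n)
-- by identifying y with x (y removed, other vertices renumbered via punchOut)
merge : ∀ {n} {x y : Fin (suc n)} → x ≢ y → Fin (suc n) → Fin n
merge {x = x} {y} x≢y v with v ≟ y
... | yes _  = punchOut (x≢y ∘ sym)
... | no v≢y = punchOut (v≢y ∘ sym)

[_≟'_] : ∀ {n} → Fin n → Fin n → ℕ
[ a ≟' b ] with a ≟ b
... | yes _ = 1
... | no _  = 0

-- adjacency of G/e: edges between distinct classes are kept, loops discarded
contract : ∀ {n} → Adj (suc n) → {x y : Fin (suc n)} → x ≢ y → Adj n
contract A x≢y u w with u ≟ w
... | yes _ = 0
... | no _  = sumℕ λ v → sumℕ λ v' →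
      [ merge x≢y v ≟' u ] Data.Nat.* [ merge x≢y v' ≟' w ] Data.Nat.* A v v'

-- For subgroups P ⊆ P′ of Div⁰ with finitely many classes, Div⁰/P is in bijection with
-- (Div⁰/P′) × (P′/P), so |Div⁰/P′| divides |Div⁰/P|. The index [Jac(G) : ⟨δ_xy⟩] is
-- |Div⁰(G)/P′| for P′ = im L_G + ⟨δ_xy⟩. Taking P = im L_G gives the divisibility into |Jac(G)|.
-- For |Jac(G/e)|, take P = π⁻¹(im L_{G/e}), where π : Div(G) → Div(G/e) pushes divisors forward
-- along the contraction: π is onto, so Div⁰(G)/P ≅ Jac(G/e); and P ⊆ P′ because
-- π (L_G (τ ∘ merge)) = L_{G/e} τ while every D differs from a divisor supported off y
-- by a multiple of δ_xy.

module Submission where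

open import Defs
open import Data.Nat using (ℕ; suc; _≤_)
open import Data.Nat.Divisibility using (_∣_)
open import Data.Nat.GCD using (gcd)
open import Data.Fin using (Fin)
open import Relation.Binary.PropositionalEquality using (_≢_)

open import Data.Nat as ℕ using (zero)
open import Data.Nat.Divisibility using (divides)
open import Data.Nat.GCD using (gcd-greatest)
import Data.Nat.Properties as ℕP
open import Data.Integer using (ℤ; +_; -_; _+_; _-_; _*_)
import Data.Integer.Properties as ℤP
open import Data.Integer.Tactic.RingSolver using (solve-∀)
open import Data.Fin using (zero; suc; punchIn; punchOut)
open import Data.Fin.Properties
  using ( _≟_; suc-injective; *↔×; cantor-schröder-bernstein
        ; punchInᵢ≢i; punchIn-injective; punchOut-cong; punchOut-punchIn; punchIn-punchOut )
open import Data.Product using (Σ; ∃-syntax; _×_; _,_; proj₁; proj₂)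
open import Data.Empty using (⊥-elim)
open import Function using (_∘_)
open import Relation.Binary.PropositionalEquality
  using (_≡_; refl; sym; trans; cong; cong₂; subst; subst₂; _≗_; module ≡-Reasoning)
open import Relation.Nullary using (yes; no; ¬_; Dec)
open import Function.Definitions using (Injective)
open import Function.Bundles using (Injection)
open import Function.Properties.Inverse using (↔⇒↣; ↔-sym)
open import Algebra.Properties.Semiring.Sum ℤP.+-*-semiring
  using (sum; sum-syntax; sum-cong-≗; sum-replicate-zero; sum-remove; ∑-distrib-+; ∑-comm; *-distribˡ-sum; *-distribʳ-sum)

sumℤ≡sum : ∀ {n} (f : Fin n → ℤ) → sumℤ f ≡ sum f
sumℤ≡sum {zero}  f = refl
sumℤ≡sum {suc n} f = cong (_+_ (f zero)) (sumℤ≡sum (f ∘ suc))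

+-sumℕ : ∀ {n} (f : Fin n → ℕ) → + sumℕ f ≡ sum (+_ ∘ f)
+-sumℕ {zero}  f = refl
+-sumℕ {suc n} f = trans (ℤP.pos-+ (f zero) (sumℕ (f ∘ suc))) (cong (_+_ (+ f zero)) (+-sumℕ (f ∘ suc)))

sum-zero : ∀ {n} (f : Fin n → ℤ) → f ≗ (λ _ → + 0) → sum f ≡ + 0
sum-zero {n} f f≗0 = trans (sum-cong-≗ f≗0) (sum-replicate-zero n)

indicator-≡ : ∀ {n} {a b : Fin n} → a ≡ b → [ a ≟' b ] ≡ 1
indicator-≡ {a = a} {b} a≡b with a ≟ b
... | yes _  = refl
... | no a≢b = ⊥-elim (a≢b a≡b)

indicator-≢ : ∀ {n} {a b : Fin n} → a ≢ b → [ a ≟' b ] ≡ 0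
indicator-≢ {a = a} {b} a≢b with a ≟ b
... | yes a≡b = ⊥-elim (a≢b a≡b)
... | no _    = refl

indicator-cong : ∀ {n m} {a b : Fin n} {c d : Fin m} →
  (a ≡ b → c ≡ d) → (c ≡ d → a ≡ b) → [ a ≟' b ] ≡ [ c ≟' d ]
indicator-cong {a = a} {b} to from with a ≟ b
... | yes a≡b = sym (indicator-≡ (to a≡b))
... | no a≢b  = sym (indicator-≢ (a≢b ∘ from))

indicator-sym : ∀ {n} (a b : Fin n) → [ a ≟' b ] ≡ [ b ≟' a ]
indicator-sym a b = indicator-cong sym sym

indicator-subst : ∀ {n} (a b : Fin n) (g : Fin n → ℤ) → + [ a ≟' b ] * g a ≡ + [ a ≟' b ] * g b
indicator-subst a b g with a ≟ b
... | yes refl = refl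
... | no _     = refl

sum-indicator : ∀ {n} (a : Fin n) (g : Fin n → ℤ) → ∑[ w < n ] (+ [ a ≟' w ] * g w) ≡ g a
sum-indicator {suc n} a g = begin
  ∑[ w < suc n ] (+ [ a ≟' w ] * g w)
    ≡⟨ sum-remove {i = a} (λ w → + [ a ≟' w ] * g w) ⟩
  + [ a ≟' a ] * g a + ∑[ w < n ] (+ [ a ≟' punchIn a w ] * g (punchIn a w))
    ≡⟨ cong₂ _+_ (cong (λ c → + c * g a) (indicator-≡ {a = a} refl)) (sum-zero _ off-diagonal) ⟩
  + 1 * g a + + 0
    ≡⟨ ℤP.+-identityʳ (+ 1 * g a) ⟩
  + 1 * g a
    ≡⟨ ℤP.*-identityˡ (g a) ⟩
  g a ∎
  where
  open ≡-Reasoning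
  off-diagonal : ∀ w → + [ a ≟' punchIn a w ] * g (punchIn a w) ≡ + 0
  off-diagonal w = cong (λ c → + c * g (punchIn a w)) (indicator-≢ (punchInᵢ≢i a w ∘ sym))

sum-neg : ∀ {n} (f : Fin n → ℤ) → ∑[ v < n ] (- f v) ≡ - sum f
sum-neg {n} f = begin
  ∑[ v < n ] (- f v)         ≡⟨ sum-cong-≗ (λ v → sym (ℤP.-1*i≡-i (f v))) ⟩
  ∑[ v < n ] (- + 1 * f v)   ≡⟨ *-distribˡ-sum (- + 1) f ⟨
  - + 1 * sum f              ≡⟨ ℤP.-1*i≡-i (sum f) ⟩
  - sum f                    ∎
  where open ≡-Reasoning

0D : ∀ {n} → Divisor n
0D _ = + 0

infixl 6 _⊕_ _⊖_

_⊕_ : ∀ {n} → Divisor n → Divisor n → Divisor n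
(D ⊕ D′) v = D v + D′ v

⊝_ : ∀ {n} → Divisor n → Divisor n
(⊝ D) v = - D v

_⊖_ : ∀ {n} → Divisor n → Divisor n → Divisor n
(D ⊖ D′) v = D v - D′ v

deg-⊕ : ∀ {n} (D D′ : Divisor n) → deg (D ⊕ D′) ≡ deg D + deg D′
deg-⊕ D D′ = begin
  deg (D ⊕ D′)     ≡⟨ sumℤ≡sum (D ⊕ D′) ⟩
  sum (D ⊕ D′)     ≡⟨ ∑-distrib-+ D D′ ⟩
  sum D + sum D′   ≡⟨ cong₂ _+_ (sumℤ≡sum D) (sumℤ≡sum D′) ⟨
  deg D + deg D′   ∎
  where open ≡-Reasoning

deg-⊝ : ∀ {n} (D : Divisor n) → deg (⊝ D) ≡ - deg D
deg-⊝ D = trans (sumℤ≡sum (⊝ D)) (trans (sum-neg D) (cong -_ (sym (sumℤ≡sum D))))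

deg-⊖ : ∀ {n} (D D′ : Divisor n) → deg (D ⊖ D′) ≡ deg D - deg D′
deg-⊖ D D′ = trans (deg-⊕ D (⊝ D′)) (cong (_+_ (deg D)) (deg-⊝ D′))

deg-cong : ∀ {n} {D D′ : Divisor n} → D ≗ D′ → deg D ≡ deg D′
deg-cong {D = D} {D′} D≗D′ = trans (sumℤ≡sum D) (trans (sum-cong-≗ D≗D′) (sym (sumℤ≡sum D′)))

Div⁰ : ∀ {n} → Divisor n → Set
Div⁰ D = deg D ≡ + 0

Div⁰-⊕ : ∀ {n} (D D′ : Divisor n) → Div⁰ D → Div⁰ D′ → Div⁰ (D ⊕ D′)
Div⁰-⊕ D D′ d d′ = trans (deg-⊕ D D′) (cong₂ _+_ d d′)

Div⁰-⊖ : ∀ {n} (D D′ : Divisor n) → Div⁰ D → Div⁰ D′ → Div⁰ (D ⊖ D′)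
Div⁰-⊖ D D′ d d′ = trans (deg-⊖ D D′) (cong₂ _-_ d d′)

Div⁰-0D : ∀ {n} → Div⁰ (0D {n})
Div⁰-0D {n} = trans (sumℤ≡sum (0D {n})) (sum-zero (0D {n}) (λ _ → refl))

record IsSubgroup {n} (P : Divisor n → Set) : Set where
  field
    ∈-resp-≗ : ∀ {E E′} → E ≗ E′ → P E → P E′
    0D∈     : P 0D
    ⊕-closed : ∀ {E E′} → P E → P E′ → P (E ⊕ E′)
    ⊝-closed : ∀ {E} → P E → P (⊝ E)

Modulo : ∀ {n} → (Divisor n → Set) → Divisor n → Divisor n → Set
Modulo P D D′ = P (D ⊖ D′)

module Congruence {n} {P : Divisor n → Set} (S : IsSubgroup P) where
  open IsSubgroup S

  infix 4 _∼_

  record _∼_ (D D′ : Divisor n) : Set where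
    constructor [_]
    field difference∈ : P (D ⊖ D′)

  ≗⇒∼ : ∀ {D D′} → D ≗ D′ → D ∼ D′
  ≗⇒∼ {D} {D′} D≗D′ = [ ∈-resp-≗ (λ v → trans (sym (ℤP.+-inverseʳ (D v))) (cong (λ c → D v - c) (D≗D′ v))) 0D∈ ]

  ∼-refl : ∀ {D} → D ∼ D
  ∼-refl = ≗⇒∼ (λ _ → refl)

  ∼-sym : ∀ {D D′} → D ∼ D′ → D′ ∼ D
  ∼-sym {D} {D′} [ p ] = [ ∈-resp-≗ (λ v → flip (D v) (D′ v)) (⊝-closed p) ]
    where
    flip : ∀ a b → - (a - b) ≡ b - a
    flip = solve-∀

  ∼-trans : ∀ {D D′ D″} → D ∼ D′ → D′ ∼ D″ → D ∼ D″
  ∼-trans {D} {D′} {D″} [ p ] [ q ] = [ ∈-resp-≗ (λ v → telescope (D v) (D′ v) (D″ v)) (⊕-closed p q) ]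
    where
    telescope : ∀ a b c → (a - b) + (b - c) ≡ a - c
    telescope = solve-∀

  ⊕-cong : ∀ {D D′ E E′} → D ∼ D′ → E ∼ E′ → D ⊕ E ∼ D′ ⊕ E′
  ⊕-cong {D} {D′} {E} {E′} [ p ] [ q ] = [ ∈-resp-≗ (λ v → regroup (D v) (D′ v) (E v) (E′ v)) (⊕-closed p q) ]
    where
    regroup : ∀ a b c d → (a - b) + (c - d) ≡ (a + c) - (b + d)
    regroup = solve-∀

  ⊕-cancelˡ : ∀ {C D D′} → C ⊕ D ∼ C ⊕ D′ → D ∼ D′
  ⊕-cancelˡ {C} {D} {D′} [ p ] = [ ∈-resp-≗ (λ v → cancel (C v) (D v) (D′ v)) p ]
    where
    cancel : ∀ c a b → (c + a) - (c + b) ≡ a - b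
    cancel = solve-∀

  ⊖-cancelʳ : ∀ {C D D′} → D ⊖ C ∼ D′ ⊖ C → D ∼ D′
  ⊖-cancelʳ {C} {D} {D′} [ p ] = [ ∈-resp-≗ (λ v → cancel (C v) (D v) (D′ v)) p ]
    where
    cancel : ∀ c a b → (a - c) - (b - c) ≡ a - b
    cancel = solve-∀

  ⊖-∼-0D : ∀ {D D′} → D ∼ D′ → D ⊖ D′ ∼ 0D
  ⊖-∼-0D {D} {D′} [ p ] = [ ∈-resp-≗ (λ v → sym (ℤP.+-identityʳ (D v - D′ v))) p ]

  ⊕-absorbʳ : ∀ {D E} → E ∼ 0D → D ⊕ E ∼ D
  ⊕-absorbʳ {D} E∼0 = ∼-trans (⊕-cong (∼-refl {D}) E∼0) (≗⇒∼ (λ v → ℤP.+-identityʳ (D v)))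

module Transversal {n} {P : Divisor n → Set} (S : IsSubgroup P) {k} (Q : QuotientCard (Modulo P) k) where
  open Congruence S

  rep : Fin k → Divisor n
  rep = proj₁ Q

  rep-Div⁰ : ∀ j → Div⁰ (rep j)
  rep-Div⁰ = proj₁ (proj₂ Q)

  rep-injective : ∀ {j j′} → rep j ∼ rep j′ → j ≡ j′
  rep-injective {j} {j′} [ p ] = proj₁ (proj₂ (proj₂ Q)) j j′ p

  class : (D : Divisor n) → Div⁰ D → Fin k
  class D d = proj₁ (proj₂ (proj₂ (proj₂ Q)) D d)

  ∼-rep-class : ∀ D (d : Div⁰ D) → D ∼ rep (class D d)
  ∼-rep-class D d = [ proj₂ (proj₂ (proj₂ (proj₂ Q)) D d) ]

record Enumeration {k} (K : Fin k → Set) : Set where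
  field
    size            : ℕ
    elem            : Fin size → Fin k
    elem∈           : ∀ t → K (elem t)
    elem-injective  : Injective _≡_ _≡_ elem
    elem-surjective : ∀ {j} → K j → ∃[ t ] elem t ≡ j

module _ {k} {K : Fin (suc k) → Set} (E : Enumeration (K ∘ suc)) where
  open Enumeration E

  enumeration-with-zero : K zero → Enumeration K
  enumeration-with-zero K0 = record
    { size = suc size ; elem = elem′ ; elem∈ = elem′∈ ; elem-injective = injective ; elem-surjective = surjective }
    where
    elem′ : Fin (suc size) → Fin (suc k)
    elem′ zero    = zero
    elem′ (suc t) = suc (elem t)

    elem′∈ : ∀ t → K (elem′ t)
    elem′∈ zero    = K0
    elem′∈ (suc t) = elem∈ t

    injective : Injective _≡_ _≡_ elem′
    injective {zero}  {zero}  _  = refl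
    injective {suc t} {suc u} eq = cong suc (elem-injective (suc-injective eq))

    surjective : ∀ {j} → K j → ∃[ t ] elem′ t ≡ j
    surjective {zero}  _  = zero , refl
    surjective {suc j} Kj with elem-surjective Kj
    ... | t , refl = suc t , refl

  enumeration-without-zero : ¬ K zero → Enumeration K
  enumeration-without-zero ¬K0 = record
    { size = size ; elem = suc ∘ elem ; elem∈ = elem∈
    ; elem-injective = elem-injective ∘ suc-injective ; elem-surjective = surjective }
    where
    surjective : ∀ {j} → K j → ∃[ t ] suc (elem t) ≡ j
    surjective {zero}  K0 = ⊥-elim (¬K0 K0)
    surjective {suc j} Kj with elem-surjective Kj
    ... | t , refl = t , refl

enumerate : ∀ {k} (K : Fin k → Set) → (∀ j → Dec (K j)) → Enumeration K
enumerate {zero}  K K? = record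
  { size = 0 ; elem = λ () ; elem∈ = λ () ; elem-injective = λ { {()} } ; elem-surjective = λ { {()} } }
enumerate {suc k} K K? with K? zero
... | yes K0 = enumeration-with-zero (enumerate (K ∘ suc) (K? ∘ suc)) K0
... | no ¬K0 = enumeration-without-zero (enumerate (K ∘ suc) (K? ∘ suc)) ¬K0

cantor-schröder-bernstein-× : ∀ {k i m} {f : Fin k → Fin i × Fin m} {g : Fin i × Fin m → Fin k} →
  Injective _≡_ _≡_ f → Injective _≡_ _≡_ g → k ≡ i ℕ.* m
cantor-schröder-bernstein-× f-inj g-inj =
  cantor-schröder-bernstein (f-inj ∘ Injection.injective (↔⇒↣ (↔-sym *↔×))) (Injection.injective (↔⇒↣ *↔×) ∘ g-inj)

module IndexDivides {n} {P P′ : Divisor n → Set} (S : IsSubgroup P) (S′ : IsSubgroup P′)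
  (P⊆P′ : ∀ {E} → P E → P′ E) {k i} (Q : QuotientCard (Modulo P) k) (Q′ : QuotientCard (Modulo P′) i) where

  open Congruence S
  open Congruence S′ using ()
    renaming ( _∼_ to _∼′_; [_] to [_]′; ∼-sym to ∼′-sym; ∼-trans to ∼′-trans
             ; ⊖-∼-0D to ⊖-∼′-0D; ⊕-absorbʳ to ⊕-absorbʳ′ )
  open Transversal S Q
  open Transversal S′ Q′ using ()
    renaming ( rep to rep′; rep-Div⁰ to rep′-Div⁰; rep-injective to rep′-injective
             ; class to class′; ∼-rep-class to ∼′-rep′-class′ )

  ∼⇒∼′ : ∀ {D D′} → D ∼ D′ → D ∼′ D′
  ∼⇒∼′ [ p ] = [ P⊆P′ p ]′

  coarsen : Fin k → Fin i
  coarsen j = class′ (rep j) (rep-Div⁰ j)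

  rep∼′rep′-coarsen : ∀ j → rep j ∼′ rep′ (coarsen j)
  rep∼′rep′-coarsen j = ∼′-rep′-class′ (rep j) (rep-Div⁰ j)

  class′-0D : Fin i
  class′-0D = class′ 0D (Div⁰-0D {n})

  Kernel : Fin k → Set
  Kernel j = coarsen j ≡ class′-0D

  Kernel⇒∼′0D : ∀ {j} → Kernel j → rep j ∼′ 0D
  Kernel⇒∼′0D {j} K = ∼′-trans (rep∼′rep′-coarsen j)
    (subst (λ a → rep′ a ∼′ 0D) (sym K) (∼′-sym (∼′-rep′-class′ 0D (Div⁰-0D {n}))))

  ∼′0D⇒Kernel : ∀ {j} → rep j ∼′ 0D → Kernel j
  ∼′0D⇒Kernel {j} r = rep′-injective
    (∼′-trans (∼′-sym (rep∼′rep′-coarsen j)) (∼′-trans r (∼′-rep′-class′ 0D (Div⁰-0D {n}))))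

  open Enumeration (enumerate Kernel (λ j → coarsen j ≟ class′-0D))

  offset-Div⁰ : ∀ j → Div⁰ (rep j ⊖ rep′ (coarsen j))
  offset-Div⁰ j = Div⁰-⊖ (rep j) (rep′ (coarsen j)) (rep-Div⁰ j) (rep′-Div⁰ (coarsen j))

  offset : Fin k → Fin k
  offset j = class (rep j ⊖ rep′ (coarsen j)) (offset-Div⁰ j)

  rep-offset : ∀ j → rep j ⊖ rep′ (coarsen j) ∼ rep (offset j)
  rep-offset j = ∼-rep-class (rep j ⊖ rep′ (coarsen j)) (offset-Div⁰ j)

  offset-Kernel : ∀ j → Kernel (offset j)
  offset-Kernel j = ∼′0D⇒Kernel (∼′-trans (∼⇒∼′ (∼-sym (rep-offset j))) (⊖-∼′-0D (rep∼′rep′-coarsen j)))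

  split : Fin k → Fin i × Fin size
  split j = coarsen j , proj₁ (elem-surjective (offset-Kernel j))

  elem-split : ∀ j → elem (proj₂ (split j)) ≡ offset j
  elem-split j = proj₂ (elem-surjective (offset-Kernel j))

  split-injective : Injective _≡_ _≡_ split
  split-injective {j} {j′} eq = rep-injective (⊖-cancelʳ {rep′ (coarsen j)}
    (∼-trans (rep-offset j)
      (subst₂ (λ o a → rep o ∼ rep j′ ⊖ rep′ a) (sym offset-eq) (sym coarsen-eq) (∼-sym (rep-offset j′)))))
    where
    coarsen-eq : coarsen j ≡ coarsen j′
    coarsen-eq = cong proj₁ eq
    offset-eq : offset j ≡ offset j′
    offset-eq = trans (sym (elem-split j)) (trans (cong (elem ∘ proj₂) eq) (elem-split j′))

  combine-Div⁰ : ∀ a t → Div⁰ (rep′ a ⊕ rep (elem t))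
  combine-Div⁰ a t = Div⁰-⊕ (rep′ a) (rep (elem t)) (rep′-Div⁰ a) (rep-Div⁰ (elem t))

  combine : Fin i × Fin size → Fin k
  combine (a , t) = class (rep′ a ⊕ rep (elem t)) (combine-Div⁰ a t)

  combine-≡ : ∀ {a t b u} → combine (a , t) ≡ combine (b , u) → rep′ a ⊕ rep (elem t) ∼ rep′ b ⊕ rep (elem u)
  combine-≡ {a} {t} {b} {u} eq = ∼-trans (∼-rep-class (rep′ a ⊕ rep (elem t)) (combine-Div⁰ a t))
    (subst (λ c → rep c ∼ rep′ b ⊕ rep (elem u)) (sym eq) (∼-sym (∼-rep-class (rep′ b ⊕ rep (elem u)) (combine-Div⁰ b u))))

  ⊕-kernel-injective : ∀ {a t b u} → rep′ a ⊕ rep (elem t) ∼ rep′ b ⊕ rep (elem u) → a ≡ b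
  ⊕-kernel-injective {a} {t} {b} {u} sums∼ = rep′-injective
    (∼′-trans (∼′-sym (⊕-absorbʳ′ {rep′ a} (Kernel⇒∼′0D (elem∈ t))))
      (∼′-trans (∼⇒∼′ sums∼) (⊕-absorbʳ′ {rep′ b} (Kernel⇒∼′0D (elem∈ u)))))

  combine-coarse : ∀ {a t b u} → combine (a , t) ≡ combine (b , u) → a ≡ b
  combine-coarse {a} {t} {b} {u} eq = ⊕-kernel-injective {a} {t} {b} {u} (combine-≡ {a} {t} {b} {u} eq)

  combine-fine : ∀ {a t b u} → a ≡ b → combine (a , t) ≡ combine (b , u) → t ≡ u
  combine-fine {a} {t} {.a} {u} refl eq =
    elem-injective (rep-injective {elem t} {elem u} (⊕-cancelˡ {rep′ a} {rep (elem t)} {rep (elem u)} (combine-≡ {a} {t} {a} {u} eq)))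

  combine-injective : Injective _≡_ _≡_ combine
  combine-injective {a , t} {b , u} eq =
    cong₂ _,_ (combine-coarse {a} {t} {b} {u} eq) (combine-fine {a} {t} {b} {u} (combine-coarse {a} {t} {b} {u} eq) eq)

  index-∣ : i ∣ k
  index-∣ = divides size (trans (cantor-schröder-bernstein-× {f = split} {combine} split-injective combine-injective) (ℕP.*-comm i size))

laplacian-as-sum : ∀ {n} (A : Adj n) (σ : Fin n → ℤ) v → laplacian A σ v ≡ ∑[ w < n ] (+ A v w * (σ v - σ w))
laplacian-as-sum {n} A σ v = begin
  + valency A v * σ v - sumℤ (λ w → + A v w * σ w)
    ≡⟨ cong₂ (λ a b → a * σ v - b) (+-sumℕ (A v)) (sumℤ≡sum (λ w → + A v w * σ w)) ⟩
  sum (+_ ∘ A v) * σ v - ∑[ w < n ] (+ A v w * σ w)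
    ≡⟨ cong₂ _-_ (*-distribʳ-sum (σ v) (+_ ∘ A v)) refl ⟩
  ∑[ w < n ] (+ A v w * σ v) - ∑[ w < n ] (+ A v w * σ w)
    ≡⟨ cong (_+_ (∑[ w < n ] (+ A v w * σ v))) (sum-neg (λ w → + A v w * σ w)) ⟨
  ∑[ w < n ] (+ A v w * σ v) + ∑[ w < n ] (- (+ A v w * σ w))
    ≡⟨ ∑-distrib-+ (λ w → + A v w * σ v) (λ w → - (+ A v w * σ w)) ⟨
  ∑[ w < n ] (+ A v w * σ v + - (+ A v w * σ w))
    ≡⟨ sum-cong-≗ (λ w → factor (+ A v w) (σ v) (σ w)) ⟩
  ∑[ w < n ] (+ A v w * (σ v - σ w)) ∎
  where
  open ≡-Reasoning
  factor : ∀ a b c → a * b + - (a * c) ≡ a * (b - c)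
  factor = solve-∀

laplacian-⊕ : ∀ {n} (A : Adj n) (σ σ′ : Fin n → ℤ) v →
  laplacian A (σ ⊕ σ′) v ≡ laplacian A σ v + laplacian A σ′ v
laplacian-⊕ {n} A σ σ′ v = begin
  laplacian A (σ ⊕ σ′) v
    ≡⟨ laplacian-as-sum A (σ ⊕ σ′) v ⟩
  ∑[ w < n ] (+ A v w * ((σ v + σ′ v) - (σ w + σ′ w)))
    ≡⟨ sum-cong-≗ (λ w → distribute (+ A v w) (σ v) (σ′ v) (σ w) (σ′ w)) ⟩
  ∑[ w < n ] (+ A v w * (σ v - σ w) + + A v w * (σ′ v - σ′ w))
    ≡⟨ ∑-distrib-+ (λ w → + A v w * (σ v - σ w)) (λ w → + A v w * (σ′ v - σ′ w)) ⟩
  ∑[ w < n ] (+ A v w * (σ v - σ w)) + ∑[ w < n ] (+ A v w * (σ′ v - σ′ w))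
    ≡⟨ cong₂ _+_ (laplacian-as-sum A σ v) (laplacian-as-sum A σ′ v) ⟨
  laplacian A σ v + laplacian A σ′ v ∎
  where
  open ≡-Reasoning
  distribute : ∀ a b b′ c c′ → a * ((b + b′) - (c + c′)) ≡ a * (b - c) + a * (b′ - c′)
  distribute = solve-∀

laplacian-⊝ : ∀ {n} (A : Adj n) (σ : Fin n → ℤ) v → laplacian A (⊝ σ) v ≡ - laplacian A σ v
laplacian-⊝ {n} A σ v = begin
  laplacian A (⊝ σ) v
    ≡⟨ laplacian-as-sum A (⊝ σ) v ⟩
  ∑[ w < n ] (+ A v w * (- σ v - - σ w))
    ≡⟨ sum-cong-≗ (λ w → negate (+ A v w) (σ v) (σ w)) ⟩
  ∑[ w < n ] (- (+ A v w * (σ v - σ w)))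
    ≡⟨ sum-neg (λ w → + A v w * (σ v - σ w)) ⟩
  - ∑[ w < n ] (+ A v w * (σ v - σ w))
    ≡⟨ cong -_ (laplacian-as-sum A σ v) ⟨
  - laplacian A σ v ∎
  where
  open ≡-Reasoning
  negate : ∀ a b c → a * (- b - - c) ≡ - (a * (b - c))
  negate = solve-∀

laplacian-0D : ∀ {n} (A : Adj n) v → laplacian A 0D v ≡ + 0
laplacian-0D A v = trans (laplacian-as-sum A 0D v) (sum-zero _ (λ w → ℤP.*-zeroʳ (+ A v w)))

-- Modulo (ImL A) and Modulo (ImL+δ A x y) are definitionally LinEquiv A and EquivModS A x y.
ImL : ∀ {n} → Adj n → Divisor n → Set
ImL {n} A E = ∃[ σ ] (∀ (v : Fin n) → E v ≡ laplacian A σ v)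

ImL-isSubgroup : ∀ {n} (A : Adj n) → IsSubgroup (ImL A)
ImL-isSubgroup A = record
  { ∈-resp-≗ = λ { E≗E′ (σ , E≡Lσ) → σ , λ v → trans (sym (E≗E′ v)) (E≡Lσ v) }
  ; 0D∈     = 0D , λ v → sym (laplacian-0D A v)
  ; ⊕-closed = λ { (σ , p) (σ′ , p′) → σ ⊕ σ′ , λ v → trans (cong₂ _+_ (p v) (p′ v)) (sym (laplacian-⊕ A σ σ′ v)) }
  ; ⊝-closed = λ { (σ , p) → ⊝ σ , λ v → trans (cong -_ (p v)) (sym (laplacian-⊝ A σ v)) }
  }

ImL+δ : ∀ {n} → Adj n → Fin n → Fin n → Divisor n → Set
ImL+δ {n} A x y E = Σ (Fin n → ℤ) λ σ → Σ ℤ λ m → ∀ (v : Fin n) → E v ≡ laplacian A σ v + m * δ x y v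

ImL+δ-isSubgroup : ∀ {n} (A : Adj n) x y → IsSubgroup (ImL+δ A x y)
ImL+δ-isSubgroup A x y = record
  { ∈-resp-≗ = λ { E≗E′ (σ , m , p) → σ , m , λ v → trans (sym (E≗E′ v)) (p v) }
  ; 0D∈     = 0D , + 0 , λ v → sym (trans (ℤP.+-identityʳ _) (laplacian-0D A v))
  ; ⊕-closed = λ { (σ , m , p) (σ′ , m′ , p′) → σ ⊕ σ′ , m + m′ , λ v →
      trans (cong₂ _+_ (p v) (p′ v))
        (trans (regroup (laplacian A σ v) (laplacian A σ′ v) m m′ (δ x y v))
               (cong (λ c → c + (m + m′) * δ x y v) (sym (laplacian-⊕ A σ σ′ v)))) }
  ; ⊝-closed = λ { (σ , m , p) → ⊝ σ , - m , λ v →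
      trans (cong -_ (p v))
        (trans (negate (laplacian A σ v) m (δ x y v))
               (cong (λ c → c + - m * δ x y v) (sym (laplacian-⊝ A σ v)))) }
  }
  where
  regroup : ∀ a a′ m m′ d → (a + m * d) + (a′ + m′ * d) ≡ (a + a′) + (m + m′) * d
  regroup = solve-∀
  negate : ∀ a m d → - (a + m * d) ≡ - a + - m * d
  negate = solve-∀

ImL⊆ImL+δ : ∀ {n} (A : Adj n) x y {E} → ImL A E → ImL+δ A x y E
ImL⊆ImL+δ A x y (σ , p) = σ , + 0 , λ v → trans (p v) (sym (ℤP.+-identityʳ (laplacian A σ v)))

pushforward : ∀ {m n} → (Fin m → Fin n) → Divisor m → Divisor n
pushforward {m} f E u = ∑[ v < m ] (+ [ f v ≟' u ] * E v)

sum-pushforward : ∀ {m n} (f : Fin m → Fin n) (E : Divisor m) (g : Fin n → ℤ) →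
  ∑[ u < n ] (pushforward f E u * g u) ≡ ∑[ v < m ] (E v * g (f v))
sum-pushforward {m} {n} f E g = begin
  ∑[ u < n ] (∑[ v < m ] (+ [ f v ≟' u ] * E v) * g u)
    ≡⟨ sum-cong-≗ (λ u → *-distribʳ-sum (g u) (λ v → + [ f v ≟' u ] * E v)) ⟩
  ∑[ u < n ] ∑[ v < m ] (+ [ f v ≟' u ] * E v * g u)
    ≡⟨ ∑-comm (λ u v → + [ f v ≟' u ] * E v * g u) ⟩
  ∑[ v < m ] ∑[ u < n ] (+ [ f v ≟' u ] * E v * g u)
    ≡⟨ sum-cong-≗ (λ v → sum-cong-≗ (λ u → reassoc (+ [ f v ≟' u ]) (E v) (g u))) ⟩
  ∑[ v < m ] ∑[ u < n ] (E v * (+ [ f v ≟' u ] * g u))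
    ≡⟨ sum-cong-≗ (λ v → *-distribˡ-sum (E v) (λ u → + [ f v ≟' u ] * g u)) ⟨
  ∑[ v < m ] (E v * ∑[ u < n ] (+ [ f v ≟' u ] * g u))
    ≡⟨ sum-cong-≗ (λ v → cong (E v *_) (sum-indicator (f v) g)) ⟩
  ∑[ v < m ] (E v * g (f v)) ∎
  where
  open ≡-Reasoning
  reassoc : ∀ a e c → a * e * c ≡ e * (a * c)
  reassoc = solve-∀

deg-pushforward : ∀ {m n} (f : Fin m → Fin n) (E : Divisor m) → deg (pushforward f E) ≡ deg E
deg-pushforward {m} {n} f E = begin
  deg (pushforward f E)                         ≡⟨ sumℤ≡sum (pushforward f E) ⟩
  ∑[ u < n ] pushforward f E u                  ≡⟨ sum-cong-≗ (λ u → ℤP.*-identityʳ (pushforward f E u)) ⟨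
  ∑[ u < n ] (pushforward f E u * + 1)          ≡⟨ sum-pushforward f E (λ _ → + 1) ⟩
  ∑[ v < m ] (E v * + 1)                        ≡⟨ sum-cong-≗ (λ v → ℤP.*-identityʳ (E v)) ⟩
  sum E                                         ≡⟨ sumℤ≡sum E ⟨
  deg E                                         ∎
  where open ≡-Reasoning

pushforward-cong : ∀ {m n} (f : Fin m → Fin n) {E E′ : Divisor m} → E ≗ E′ → pushforward f E ≗ pushforward f E′
pushforward-cong f E≗E′ u = sum-cong-≗ (λ v → cong (+ [ f v ≟' u ] *_) (E≗E′ v))

pushforward-⊕ : ∀ {m n} (f : Fin m → Fin n) (E E′ : Divisor m) →
  pushforward f (E ⊕ E′) ≗ pushforward f E ⊕ pushforward f E′
pushforward-⊕ f E E′ u =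
  trans (sum-cong-≗ (λ v → ℤP.*-distribˡ-+ (+ [ f v ≟' u ]) (E v) (E′ v)))
        (∑-distrib-+ (λ v → + [ f v ≟' u ] * E v) (λ v → + [ f v ≟' u ] * E′ v))

pushforward-⊝ : ∀ {m n} (f : Fin m → Fin n) (E : Divisor m) → pushforward f (⊝ E) ≗ ⊝ pushforward f E
pushforward-⊝ f E u =
  trans (sum-cong-≗ (λ v → sym (ℤP.neg-distribʳ-* (+ [ f v ≟' u ]) (E v))))
        (sum-neg (λ v → + [ f v ≟' u ] * E v))

pushforward-⊖ : ∀ {m n} (f : Fin m → Fin n) (E E′ : Divisor m) →
  pushforward f (E ⊖ E′) ≗ pushforward f E ⊖ pushforward f E′
pushforward-⊖ f E E′ u =
  trans (pushforward-⊕ f E (⊝ E′) u) (cong (_+_ (pushforward f E u)) (pushforward-⊝ f E′ u))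

pushforward-injective : ∀ {m n} {f : Fin m → Fin n} → Injective _≡_ _≡_ f →
  ∀ (E : Divisor m) v → pushforward f E (f v) ≡ E v
pushforward-injective {f = f} f-inj E v =
  trans (sum-cong-≗ (λ w → cong (λ c → + c * E w) (indicator-cong (sym ∘ f-inj) (cong f ∘ sym))))
        (sum-indicator v E)

pushforward-outside-image : ∀ {m n} (f : Fin m → Fin n) (E : Divisor m) {u} → (∀ v → f v ≢ u) →
  pushforward f E u ≡ + 0
pushforward-outside-image f E u∉im = sum-zero _ (λ v → cong (λ c → + c * E v) (indicator-≢ (u∉im v)))

preimage-isSubgroup : ∀ {m n} (f : Fin m → Fin n) {P : Divisor n → Set} →
  IsSubgroup P → IsSubgroup (P ∘ pushforward f)
preimage-isSubgroup f S = record
  { ∈-resp-≗ = λ E≗E′ → ∈-resp-≗ (pushforward-cong f E≗E′)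
  ; 0D∈     = ∈-resp-≗ (λ u → sym (sum-zero _ (λ v → ℤP.*-zeroʳ (+ [ f v ≟' u ])))) 0D∈
  ; ⊕-closed = λ {E} {E′} p q → ∈-resp-≗ (λ u → sym (pushforward-⊕ f E E′ u)) (⊕-closed p q)
  ; ⊝-closed = λ {E} p → ∈-resp-≗ (λ u → sym (pushforward-⊝ f E u)) (⊝-closed p)
  }
  where open IsSubgroup S

quotientCard-preimage : ∀ {m n} (f : Fin m → Fin n) (s : Divisor n → Divisor m) → (∀ E → pushforward f (s E) ≗ E) →
  ∀ {P : Divisor n → Set} {k} → (∀ {E E′} → E ≗ E′ → P E → P E′) →
  QuotientCard (Modulo P) k → QuotientCard (Modulo (P ∘ pushforward f)) k
quotientCard-preimage f s section {P} resp (rep , rep-Div⁰ , rep-distinct , rep-complete) =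
  s ∘ rep , s∘rep-Div⁰ , s∘rep-distinct , s∘rep-complete
  where
  s∘rep-Div⁰ : ∀ a → Div⁰ (s (rep a))
  s∘rep-Div⁰ a = trans (sym (deg-pushforward f (s (rep a)))) (trans (deg-cong (section (rep a))) (rep-Div⁰ a))

  ⊖-s : ∀ D a → pushforward f (D ⊖ s (rep a)) ≗ pushforward f D ⊖ rep a
  ⊖-s D a u = trans (pushforward-⊖ f D (s (rep a)) u) (cong (_-_ (pushforward f D u)) (section (rep a) u))

  s∘rep-distinct : ∀ a b → P (pushforward f (s (rep a) ⊖ s (rep b))) → a ≡ b
  s∘rep-distinct a b p = rep-distinct a b
    (resp (λ u → trans (⊖-s (s (rep a)) b u) (cong (_- rep b u) (section (rep a) u))) p)

  s∘rep-complete : ∀ D → Div⁰ D → ∃[ a ] P (pushforward f (D ⊖ s (rep a)))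
  s∘rep-complete D d with rep-complete (pushforward f D) (trans (deg-pushforward f D) d)
  ... | a , p = a , resp (λ u → sym (⊖-s D a u)) p

quotientGraph : ∀ {m n} → (Fin m → Fin n) → Adj m → Adj n
quotientGraph f A u w = sumℕ λ v → sumℕ λ v′ → [ f v ≟' u ] ℕ.* [ f v′ ≟' w ] ℕ.* A v v′

+-quotientGraph : ∀ {m n} (f : Fin m → Fin n) (A : Adj m) u w →
  + quotientGraph f A u w ≡ pushforward f (λ v′ → ∑[ v < m ] (+ [ f v ≟' u ] * + A v v′)) w
+-quotientGraph {m} f A u w = begin
  + quotientGraph f A u w
    ≡⟨ +-sumℕ (λ v → sumℕ λ v′ → [ f v ≟' u ] ℕ.* [ f v′ ≟' w ] ℕ.* A v v′) ⟩
  ∑[ v < m ] (+ sumℕ λ v′ → [ f v ≟' u ] ℕ.* [ f v′ ≟' w ] ℕ.* A v v′)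
    ≡⟨ sum-cong-≗ (λ v → trans (+-sumℕ (λ v′ → [ f v ≟' u ] ℕ.* [ f v′ ≟' w ] ℕ.* A v v′))
                                (sum-cong-≗ (λ v′ → +-* [ f v ≟' u ] [ f v′ ≟' w ] (A v v′)))) ⟩
  ∑[ v < m ] ∑[ v′ < m ] (+ [ f v ≟' u ] * + [ f v′ ≟' w ] * + A v v′)
    ≡⟨ ∑-comm (λ v v′ → + [ f v ≟' u ] * + [ f v′ ≟' w ] * + A v v′) ⟩
  ∑[ v′ < m ] ∑[ v < m ] (+ [ f v ≟' u ] * + [ f v′ ≟' w ] * + A v v′)
    ≡⟨ sum-cong-≗ (λ v′ → sum-cong-≗ (λ v → reassoc (+ [ f v ≟' u ]) (+ [ f v′ ≟' w ]) (+ A v v′))) ⟩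
  ∑[ v′ < m ] ∑[ v < m ] (+ [ f v′ ≟' w ] * (+ [ f v ≟' u ] * + A v v′))
    ≡⟨ sum-cong-≗ (λ v′ → *-distribˡ-sum (+ [ f v′ ≟' w ]) (λ v → + [ f v ≟' u ] * + A v v′)) ⟨
  ∑[ v′ < m ] (+ [ f v′ ≟' w ] * ∑[ v < m ] (+ [ f v ≟' u ] * + A v v′)) ∎
  where
  open ≡-Reasoning
  +-* : ∀ a b c → + (a ℕ.* b ℕ.* c) ≡ + a * + b * + c
  +-* a b c = trans (ℤP.pos-* (a ℕ.* b) c) (cong (_* + c) (ℤP.pos-* a b))
  reassoc : ∀ a b c → a * b * c ≡ b * (a * c)
  reassoc = solve-∀

laplacian-quotientGraph : ∀ {m n} (f : Fin m → Fin n) (A : Adj m) (τ : Fin n → ℤ) u →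
  pushforward f (laplacian A (τ ∘ f)) u ≡ laplacian (quotientGraph f A) τ u
laplacian-quotientGraph {m} {n} f A τ u = begin
  pushforward f (laplacian A (τ ∘ f)) u
    ≡⟨ sum-cong-≗ (λ v → cong (+ [ f v ≟' u ] *_) (laplacian-as-sum A (τ ∘ f) v)) ⟩
  ∑[ v < m ] (+ [ f v ≟' u ] * ∑[ v′ < m ] (+ A v v′ * (τ (f v) - τ (f v′))))
    ≡⟨ sum-cong-≗ (λ v → *-distribˡ-sum (+ [ f v ≟' u ]) (λ v′ → + A v v′ * (τ (f v) - τ (f v′)))) ⟩
  ∑[ v < m ] ∑[ v′ < m ] (+ [ f v ≟' u ] * (+ A v v′ * (τ (f v) - τ (f v′))))
    ≡⟨ sum-cong-≗ (λ v → sum-cong-≗ (λ v′ → on-fibre v v′)) ⟩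
  ∑[ v < m ] ∑[ v′ < m ] (+ [ f v ≟' u ] * + A v v′ * (τ u - τ (f v′)))
    ≡⟨ ∑-comm (λ v v′ → + [ f v ≟' u ] * + A v v′ * (τ u - τ (f v′))) ⟩
  ∑[ v′ < m ] ∑[ v < m ] (+ [ f v ≟' u ] * + A v v′ * (τ u - τ (f v′)))
    ≡⟨ sum-cong-≗ (λ v′ → *-distribʳ-sum (τ u - τ (f v′)) (λ v → + [ f v ≟' u ] * + A v v′)) ⟨
  ∑[ v′ < m ] (∑[ v < m ] (+ [ f v ≟' u ] * + A v v′) * (τ u - τ (f v′)))
    ≡⟨ sum-pushforward f (λ v′ → ∑[ v < m ] (+ [ f v ≟' u ] * + A v v′)) (λ w → τ u - τ w) ⟨
  ∑[ w < n ] (pushforward f (λ v′ → ∑[ v < m ] (+ [ f v ≟' u ] * + A v v′)) w * (τ u - τ w))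
    ≡⟨ sum-cong-≗ (λ w → cong (_* (τ u - τ w)) (+-quotientGraph f A u w)) ⟨
  ∑[ w < n ] (+ quotientGraph f A u w * (τ u - τ w))
    ≡⟨ laplacian-as-sum (quotientGraph f A) τ u ⟨
  laplacian (quotientGraph f A) τ u ∎
  where
  open ≡-Reasoning
  on-fibre : ∀ v v′ → + [ f v ≟' u ] * (+ A v v′ * (τ (f v) - τ (f v′))) ≡ + [ f v ≟' u ] * + A v v′ * (τ u - τ (f v′))
  on-fibre v v′ = trans (indicator-subst (f v) u (λ z → + A v v′ * (τ z - τ (f v′))))
                        (sym (ℤP.*-assoc (+ [ f v ≟' u ]) (+ A v v′) (τ u - τ (f v′))))

laplacian-offDiagonal : ∀ {n} {A B : Adj n} → (∀ u w → u ≢ w → A u w ≡ B u w) →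
  ∀ (τ : Fin n → ℤ) u → laplacian A τ u ≡ laplacian B τ u
laplacian-offDiagonal {n} {A} {B} A≡B τ u =
  trans (laplacian-as-sum A τ u) (trans (sum-cong-≗ term) (sym (laplacian-as-sum B τ u)))
  where
  term : ∀ w → + A u w * (τ u - τ w) ≡ + B u w * (τ u - τ w)
  term w with u ≟ w
  ... | yes refl = trans (cong (+ A u u *_) (ℤP.+-inverseʳ (τ u)))
                   (trans (ℤP.*-zeroʳ (+ A u u)) (sym (trans (cong (+ B u u *_) (ℤP.+-inverseʳ (τ u))) (ℤP.*-zeroʳ (+ B u u)))))
  ... | no u≢w = cong (λ c → + c * (τ u - τ w)) (A≡B u w u≢w)

≗-by-punchIn : ∀ {n} (y : Fin (suc n)) {D D′ : Divisor (suc n)} →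
  D y ≡ D′ y → (∀ u → D (punchIn y u) ≡ D′ (punchIn y u)) → D ≗ D′
≗-by-punchIn y {D} {D′} at-y off-y v with v ≟ y
... | yes refl = at-y
... | no v≢y = subst (λ w → D w ≡ D′ w) (punchIn-punchOut (v≢y ∘ sym)) (off-y (punchOut (v≢y ∘ sym)))

module Contraction {n} (A : Adj (suc n)) {x y : Fin (suc n)} (x≢y : x ≢ y) where

  -- the vertex of G/e into which x and y are merged
  x/e : Fin n
  x/e = punchOut (x≢y ∘ sym)

  punchIn-x/e : punchIn y x/e ≡ x
  punchIn-x/e = punchIn-punchOut (x≢y ∘ sym)

  merge-y : merge x≢y y ≡ x/e
  merge-y with y ≟ y
  ... | yes _  = refl
  ... | no y≢y = ⊥-elim (y≢y refl)

  merge-punchIn : ∀ u → merge x≢y (punchIn y u) ≡ u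
  merge-punchIn u with punchIn y u ≟ y
  ... | yes eq = ⊥-elim (punchInᵢ≢i y u eq)
  ... | no _   = trans (punchOut-cong y refl) (punchOut-punchIn y)

  π : Divisor (suc n) → Divisor n
  π = pushforward (merge x≢y)

  π-fibres : ∀ E u → π E u ≡ E (punchIn y u) + + [ x/e ≟' u ] * E y
  π-fibres E u = begin
    π E u
      ≡⟨ sum-remove {i = y} (λ v → + [ merge x≢y v ≟' u ] * E v) ⟩
    + [ merge x≢y y ≟' u ] * E y + ∑[ w < n ] (+ [ merge x≢y (punchIn y w) ≟' u ] * E (punchIn y w))
      ≡⟨ cong₂ _+_ (cong (λ z → + [ z ≟' u ] * E y) merge-y) (sum-cong-≗ merged) ⟩
    + [ x/e ≟' u ] * E y + ∑[ w < n ] (+ [ u ≟' w ] * E (punchIn y w))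
      ≡⟨ cong (_+_ (+ [ x/e ≟' u ] * E y)) (sum-indicator u (E ∘ punchIn y)) ⟩
    + [ x/e ≟' u ] * E y + E (punchIn y u)
      ≡⟨ ℤP.+-comm (+ [ x/e ≟' u ] * E y) (E (punchIn y u)) ⟩
    E (punchIn y u) + + [ x/e ≟' u ] * E y ∎
    where
    open ≡-Reasoning
    merged : ∀ w → + [ merge x≢y (punchIn y w) ≟' u ] * E (punchIn y w) ≡ + [ u ≟' w ] * E (punchIn y w)
    merged w = cong (λ c → + c * E (punchIn y w)) (trans (cong (λ z → [ z ≟' u ]) (merge-punchIn w)) (indicator-sym w u))

  extend : Divisor n → Divisor (suc n)
  extend = pushforward (punchIn y)

  extend-y : ∀ E → extend E y ≡ + 0
  extend-y E = pushforward-outside-image (punchIn y) E (punchInᵢ≢i y)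

  extend-punchIn : ∀ E u → extend E (punchIn y u) ≡ E u
  extend-punchIn = pushforward-injective (λ {u} {w} → punchIn-injective y u w)

  π-extend : ∀ E → π (extend E) ≗ E
  π-extend E u = begin
    π (extend E) u
      ≡⟨ π-fibres (extend E) u ⟩
    extend E (punchIn y u) + + [ x/e ≟' u ] * extend E y
      ≡⟨ cong₂ (λ a b → a + + [ x/e ≟' u ] * b) (extend-punchIn E u) (extend-y E) ⟩
    E u + + [ x/e ≟' u ] * + 0
      ≡⟨ cong (_+_ (E u)) (ℤP.*-zeroʳ (+ [ x/e ≟' u ])) ⟩
    E u + + 0
      ≡⟨ ℤP.+-identityʳ (E u) ⟩
    E u ∎
    where open ≡-Reasoning

  δ-y : δ x y y ≡ + 1
  δ-y with y ≟ x | y ≟ y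
  ... | yes y≡x | _     = ⊥-elim (x≢y (sym y≡x))
  ... | no _    | yes _ = refl
  ... | no _    | no y≢y = ⊥-elim (y≢y refl)

  δ-punchIn : ∀ u → δ x y (punchIn y u) ≡ - + [ x/e ≟' u ]
  δ-punchIn u with punchIn y u ≟ x | punchIn y u ≟ y
  ... | yes ↑u≡x | _       = cong (-_ ∘ +_) (sym (indicator-≡ (punchIn-injective y x/e u (trans punchIn-x/e (sym ↑u≡x)))))
  ... | no _     | yes ↑u≡y = ⊥-elim (punchInᵢ≢i y u ↑u≡y)
  ... | no ↑u≢x  | no _     =
    cong (-_ ∘ +_) (sym (indicator-≢ (λ x/e≡u → ↑u≢x (trans (cong (punchIn y) (sym x/e≡u)) punchIn-x/e))))

  decompose : ∀ D v → D v ≡ extend (π D) v + D y * δ x y v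
  decompose D = ≗-by-punchIn y at-y off-y
    where
    at-y : D y ≡ extend (π D) y + D y * δ x y y
    at-y = sym (trans (cong₂ (λ a b → a + D y * b) (extend-y (π D)) δ-y)
                      (trans (ℤP.+-identityˡ (D y * + 1)) (ℤP.*-identityʳ (D y))))
    cancel : ∀ a c i → a ≡ (a + i * c) + c * - i
    cancel = solve-∀
    off-y : ∀ u → D (punchIn y u) ≡ extend (π D) (punchIn y u) + D y * δ x y (punchIn y u)
    off-y u = trans (cancel (D (punchIn y u)) (D y) (+ [ x/e ≟' u ]))
      (sym (cong₂ (λ a b → a + D y * b) (trans (extend-punchIn (π D) u) (π-fibres D u)) (δ-punchIn u)))

  laplacian-contract : ∀ (τ : Fin n → ℤ) u → π (laplacian A (τ ∘ merge x≢y)) u ≡ laplacian (contract A x≢y) τ u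
  laplacian-contract τ u = trans (laplacian-quotientGraph (merge x≢y) A τ u) (laplacian-offDiagonal loops-only τ u)
    where
    loops-only : ∀ u w → u ≢ w → quotientGraph (merge x≢y) A u w ≡ contract A x≢y u w
    loops-only u w u≢w with u ≟ w
    ... | yes u≡w = ⊥-elim (u≢w u≡w)
    ... | no _    = refl

  preimage⊆ImL+δ : ∀ {E} → ImL (contract A x≢y) (π E) → ImL+δ A x y E
  preimage⊆ImL+δ {E} (τ , πE≡Lτ) = τ ∘ merge x≢y , E y - L y , λ v → begin
    E v
      ≡⟨ decompose E v ⟩
    extend (π E) v + E y * δ x y v
      ≡⟨ cong (λ a → a + E y * δ x y v) (pushforward-cong (punchIn y) πE≗πL v) ⟩
    extend (π L) v + E y * δ x y v
      ≡⟨ shift (extend (π L) v) (E y) (L y) (δ x y v) ⟩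
    (extend (π L) v + L y * δ x y v) + (E y - L y) * δ x y v
      ≡⟨ cong (λ a → a + (E y - L y) * δ x y v) (decompose L v) ⟨
    L v + (E y - L y) * δ x y v ∎
    where
    open ≡-Reasoning
    L : Divisor (suc n)
    L = laplacian A (τ ∘ merge x≢y)
    πE≗πL : π E ≗ π L
    πE≗πL u = trans (πE≡Lτ u) (sym (laplacian-contract τ u))
    shift : ∀ a e l d → a + e * d ≡ (a + l * d) + (e - l) * d
    shift = solve-∀

corollary4p1 : ∀ (n : ℕ) (A : Adj (suc n)) → Symmetric A → Loopless A → Connected A →
    (x y : Fin (suc n)) (x≢y : x ≢ y) → 1 ≤ A x y →
    (jG jGe i : ℕ) → JacOrder A jG → JacOrder (contract A x≢y) jGe → JacIndexδ A x y i →
    i ∣ gcd jG jGe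
corollary4p1 n A _ _ _ x y x≢y _ jG jGe i JG JGe JI = gcd-greatest i∣jG i∣jGe
  where
  open Contraction A x≢y

  Sδ : IsSubgroup (ImL+δ A x y)
  Sδ = ImL+δ-isSubgroup A x y

  i∣jG : i ∣ jG
  i∣jG = IndexDivides.index-∣ (ImL-isSubgroup A) Sδ (ImL⊆ImL+δ A x y) JG JI

  ImL/e : IsSubgroup (ImL (contract A x≢y))
  ImL/e = ImL-isSubgroup (contract A x≢y)

  i∣jGe : i ∣ jGe
  i∣jGe = IndexDivides.index-∣ (preimage-isSubgroup (merge x≢y) ImL/e) Sδ preimage⊆ImL+δ
    (quotientCard-preimage (merge x≢y) extend π-extend (IsSubgroup.∈-resp-≗ ImL/e) JGe) JI
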